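{- Let $r\geqslant 2$, let $F$ be a graph with $ex(n,F)=t_r(n)+O(1)$, and let $c_0$ be the integer associated with $F$ as in the context. There exists $\epsilon_0>0$ such that for every $0<\epsilon<\epsilon_0$ there is $N$ such that the following holds for all $n\geqslant N$. Let $G\in\mathcal{G}_n$ be $F$-saturated, and let $V_1,\dots,V_r$ be the (unique) partition of $V(G)$ with $e(V_i)\leqslant c_0$ for all $i$. For $1\leqslant i\leqslant r$ let $A_i=\{v\in V_i: d_{V_i}(v)\geqslant 1\}$ and $B_i=V_i\setminus A_i$. Then $|A_i|\leqslant 2c_0$ for every $i$, $e(G_{out})\leqslant 2(r-1)rc_0^2$, and every vertex $u\in B_i$ is adjacent to every vertex of $V(G)\setminus V_i$, for every $1\leqslant i\leqslant r$.
   Context: Graphs are finite and simple; $F$-free means containing no subgraph isomorphic to $F$. A graph $G$ is $F$-saturated if it is $F$-free but adding any edge of its complement creates a copy of $F$. $ex(n,F)$ is the maximum number of edges of an $n$-vertex $F$-free graph; $T_r(n)$ is the complete $r$-partite graph on $n$ vertices with part sizes differing by at most $1$ and $t_r(n)=e(T_r(n))$. For such $F$, $c_0=\lim_{k\to\infty}\sup_{n\geqslant k}\{ex(n,F)-t_r(n)\}$ (an integer). For $\epsilon>0$, $\mathcal{G}_n$ is the set of $n$-vertex $F$-free graphs with minimum degree greater than $\left(1-\frac1r-\epsilon\right)n$. For $A\subseteq V(G)$, $e(A)$ is the number of edges of $G$ with both ends in $A$ and $d_A(v)$ is the number of neighbours of $v$ in $A$. (For $\epsilon$ small and $n$ large,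 every $G\in\mathcal{G}_n$ has a unique partition $V_1,\dots,V_r$ with all $e(V_i)\leqslant c_0$.) $G_{out}$ is the graph on $V(G)$ whose edges are the pairs $\{u,v\}$ with $u\in V_i$, $v\in V_j$, $i\neq j$, and $uv\notin E(G)$.
   Formalization: The parameter ε ranges only over rational values in (0, ε₀), and ε₀ is likewise taken to be rational. -}

module Defs where

open import Data.Nat using (ℕ; zero; suc; _+_; _*_; _≤_; _<_; _<ᵇ_; NonZero)
open import Data.Nat.DivMod using (_%_)
open import Data.Nat.Properties using (_≟_)
open import Data.Bool using (Bool; true; false; _∧_; _∨_; not; if_then_else_)
open import Data.Fin using (Fin; toℕ)
open import Data.Fin.Properties as FinP using ()
open import Data.List using (List; map; allFin)
open import Data.Nat.ListAction using (sum)
open import Data.Integer as ℤ using (ℤ; +_)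
open import Data.Product using (Σ; _×_; ∃; ∃-syntax)
open import Function.Definitions using (Injective)
open import Relation.Binary.PropositionalEquality using (_≡_; _≢_)
open import Relation.Nullary.Decidable using (⌊_⌋)

record Graph (n : ℕ) : Set where
  field
    adj   : Fin n → Fin n → Bool
    adj-sym : ∀ u v → adj u v ≡ adj v u
    adj-irrefl : ∀ v → adj v v ≡ false
open Graph public

count : ∀ {n} → (Fin n → Bool) → ℕ
count {n} p = sum (map (λ i → if p i then 1 else 0) (allFin n))

-- number of unordered pairs {i,j} (i ≠ j) of Fin n satisfying a symmetric predicate
countPairs : ∀ {n} → (Fin n → Fin n → Bool) → ℕ
countPairs {n} q = sum (map (λ i → count (λ j → (toℕ i <ᵇ toℕ j) ∧ q i j)) (allFin n))

edges : ∀ {n} → Graph n → ℕ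
edges G = countPairs (adj G)

edgesIn : ∀ {n} → Graph n → (Fin n → Bool) → ℕ
edgesIn G A = countPairs (λ u v → A u ∧ A v ∧ adj G u v)

degIn : ∀ {n} → Graph n → (Fin n → Bool) → Fin n → ℕ
degIn G A v = count (λ u → A u ∧ adj G v u)

deg : ∀ {n} → Graph n → Fin n → ℕ
deg G v = count (λ u → adj G v u)

ContainsAdj : ∀ {k n} → (Fin k → Fin k → Bool) → (Fin n → Fin n → Bool) → Set
ContainsAdj {k} {n} f h =
  Σ (Fin k → Fin n) λ φ → Injective _≡_ _≡_ φ × (∀ a b → f a b ≡ true → h (φ a) (φ b) ≡ true)

Contains : ∀ {k n} → Graph k → Graph n → Set
Contains F G = ContainsAdj (adj F) (adj G)

Free : ∀ {k n} → Graph k → Graph n → Set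
Free F G = Contains F G → Data.Empty.⊥
  where import Data.Empty

addEdge : ∀ {n} → (Fin n → Fin n → Bool) → Fin n → Fin n → (Fin n → Fin n → Bool)
addEdge h u v x y =
  h x y ∨ (⌊ x FinP.≟ u ⌋ ∧ ⌊ y FinP.≟ v ⌋) ∨ (⌊ x FinP.≟ v ⌋ ∧ ⌊ y FinP.≟ u ⌋)

Saturated : ∀ {k n} → Graph k → Graph n → Set
Saturated F G =
  Free F G × (∀ u v → u ≢ v → adj G u v ≡ false → ContainsAdj (adj F) (addEdge (adj G) u v))

IsEx : ∀ {k} → Graph k → ℕ → ℕ → Set
IsEx F n m = (∀ (G : Graph n) → Free F G → edges G ≤ m) × (Σ (Graph n) λ G → Free F G × edges G ≡ m)

-- Turán graph T_r(n): vertex i in part (i mod r); parts sizes differ by at most 1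
turanAdj : (r : ℕ) .{{_ : NonZero r}} (n : ℕ) → Fin n → Fin n → Bool
turanAdj r n i j = not ⌊ (toℕ i % r) ≟ (toℕ j % r) ⌋

turan : (r : ℕ) .{{_ : NonZero r}} (n : ℕ) → Graph n
turan r n = record { adj = turanAdj r n ; adj-sym = symP ; adj-irrefl = irr }
  where
  open import Relation.Binary.PropositionalEquality using (refl; sym)
  open import Relation.Nullary using (yes; no)
  symP : ∀ u v → turanAdj r n u v ≡ turanAdj r n v u
  symP u v with (toℕ u % r) ≟ (toℕ v % r) | (toℕ v % r) ≟ (toℕ u % r)
  ... | yes _ | yes _ = refl
  ... | no _ | no _ = refl
  ... | yes p | no q = Data.Empty.⊥-elim (q (sym p)) where import Data.Empty
  ... | no p | yes q = Data.Empty.⊥-elim (p (sym q)) where import Data.Empty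
  irr : ∀ v → turanAdj r n v v ≡ false
  irr v with (toℕ v % r) ≟ (toℕ v % r)
  ... | yes _ = refl
  ... | no p = Data.Empty.⊥-elim (p refl) where import Data.Empty

t : (r : ℕ) .{{_ : NonZero r}} (n : ℕ) → ℕ
t r n = edges (turan r n)

IsSupFrom : (ℕ → ℤ) → ℕ → ℤ → Set
IsSupFrom a k s =
  (∀ n → k ≤ n → a n ℤ.≤ s) × (∀ b → (∀ n → k ≤ n → a n ℤ.≤ b) → s ℤ.≤ b)

-- c = lim_{k→∞} sup_{n≥k} a n, for an integer-valued sequence with integer limit:
-- the (integer) sups equal c from some k on
IsLimSup : (ℕ → ℤ) → ℤ → Set
IsLimSup a c = ∃[ K ] (∀ k → K ≤ k → IsSupFrom a k c)

inPart : ∀ {n r} → (Fin n → Fin r) → Fin r → Fin n → Bool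
inPart part i v = ⌊ part v FinP.≟ i ⌋

edgesOut : ∀ {n r} → Graph n → (Fin n → Fin r) → ℕ
edgesOut G part = countPairs (λ u v → not ⌊ part u FinP.≟ part v ⌋ ∧ not (adj G u v))

sizeA : ∀ {n r} → Graph n → (Fin n → Fin r) → Fin r → ℕ
sizeA G part i = count (λ v → inPart part i v ∧ (0 <ᵇ degIn G (inPart part i) v))

{-# OPTIONS --safe #-}
module Submission where

open import Defs
open import Data.Nat using (ℕ; _≤_; _*_; _∸_; NonZero)
open import Data.Integer as ℤ using (ℤ; +_; ∣_∣)
open import Data.Integer using (-[1+_])
open import Data.Rational as ℚ using (ℚ; 0ℚ; 1ℚ)
open import Data.Fin using (Fin)
open import Data.Bool using (true; false)
open import Data.Product using (Σ; _×_; ∃-syntax)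
open import Relation.Binary.PropositionalEquality using (_≡_)

open import Data.Nat as ℕ using (zero; suc; _+_; _<_; _<ᵇ_; z≤n; s≤s)
open import Data.Nat.Properties
open import Data.Nat.ListAction as List using ()
open import Data.Nat.Tactic.RingSolver using (solve-∀)
open import Data.Bool using (Bool; T; not; _∧_; _∨_; if_then_else_)
open import Data.Bool.Properties using (∧-conicalˡ; ∧-conicalʳ; ¬-not)
open import Data.Fin using (toℕ; punchIn) renaming (zero to 0F; suc to sucF)
open import Data.Fin.Properties using (punchInᵢ≢i; toℕ-injective) renaming (_≟_ to _≟F_)
open import Data.List using (map; allFin; tabulate)
open import Data.List.Properties using (map-tabulate)
open import Data.Vec.Functional using (removeAt; _∷_)
open import Data.Product using (_,_; proj₁)
open import Data.Sum using (_⊎_; inj₁; inj₂)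
open import Data.Empty using (⊥-elim)
open import Function using (_∘_)
open import Function.Definitions using (Injective)
open import Relation.Binary.PropositionalEquality using (_≢_; refl; sym; trans; cong; cong₂; subst; subst₂; module ≡-Reasoning)
open import Relation.Nullary using (¬_; yes; no)
open import Relation.Nullary.Decidable using (⌊_⌋)
import Data.Integer.Properties as ZP
import Data.Integer.Tactic.RingSolver as ZS
import Data.Rational.Properties as QP
open import Data.Rational.Unnormalised as ᵘ using (ℚᵘ; mkℚᵘ)
import Data.Rational.Unnormalised.Properties as UP
open import Algebra.Properties.Semiring.Sum +-*-semiring
  using (sum; sum-syntax; sum-cong-≗; sum-remove; ∑-distrib-+; ∑-comm; *-distribˡ-sum; *-distribʳ-sum)

-- Write R = suc r₁ for the number of parts. The degree condition leaves every vertex fewer than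
-- (1/R + ε) n non-neighbours, and e(V_i) ≤ c₀ bounds degrees inside the parts, so every part has
-- about n/R vertices and a vertex outside V_i misses only about R ε n of them. Hence, for
-- ε < 1/((k+2)R²) and n large, for any k + 1 vertices some y ∈ V_i distinct from them is adjacent
-- to all of them that lie outside V_i. If u ∈ B_i were not adjacent to some w ∉ V_i, saturation
-- would give a copy of F in G + uw; as u has no neighbour in V_i, replacing u by such a y for w and
-- the copy puts F inside G. So every edge of G_out joins vertices of A = ⋃ A_i in different parts,
-- and |A_i| ≤ 2 e(V_i) ≤ 2c₀ gives 2 e(G_out) ≤ R·2c₀ · r₁·2c₀.

-- Sums and counts over Fin n

true≢false : true ≢ false
true≢false ()

sum-const : ∀ n c → ∑[ i < n ] c ≡ n * c
sum-const zero    c = refl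
sum-const (suc n) c = cong (_+_ c) (sum-const n c)

sum-mono-≤ : ∀ {n} {f g : Fin n → ℕ} → (∀ i → f i ≤ g i) → sum f ≤ sum g
sum-mono-≤ {zero}  f≤g = z≤n
sum-mono-≤ {suc n} f≤g = +-mono-≤ (f≤g 0F) (sum-mono-≤ (f≤g ∘ sucF))

sum-≤-const : ∀ {n} (f : Fin n → ℕ) {c} → (∀ i → f i ≤ c) → sum f ≤ n * c
sum-≤-const {n} f {c} f≤c = ≤-trans (sum-mono-≤ f≤c) (≤-reflexive (sum-const n c))

≤-sum : ∀ {n} (f : Fin n → ℕ) i → f i ≤ sum f
≤-sum f 0F        = m≤m+n _ _
≤-sum f (sucF i)  = ≤-trans (≤-sum (f ∘ sucF) i) (m≤n+m _ _)

sum-≤-except : ∀ {m} (f : Fin (suc m) → ℕ) j {c} → (∀ i → i ≢ j → f i ≤ c) → sum f ≤ f j + m * c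
sum-≤-except {m} f j {c} f≤c = begin
  sum f                      ≡⟨ sum-remove {i = j} f ⟩
  f j + sum (removeAt f j)   ≤⟨ +-monoʳ-≤ (f j) (sum-≤-const _ (λ i → f≤c (punchIn j i) (punchInᵢ≢i j i))) ⟩
  f j + m * c                ∎
  where open ≤-Reasoning

sum-witness : ∀ {n} (f : Fin n → ℕ) → 0 < sum f → ∃[ i ] 0 < f i
sum-witness {suc n} f pos with f 0F in eq
... | suc _ = 0F , subst (0 <_) (sym eq) (s≤s z≤n)
... | zero  = let (i , fi>0) = sum-witness (f ∘ sucF) pos in sucF i , fi>0

𝟙 : Bool → ℕ
𝟙 b = if b then 1 else 0

sum-𝟙-≟ : ∀ {n} (a : Fin n) → ∑[ l < n ] 𝟙 ⌊ a ≟F l ⌋ ≡ 1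
sum-𝟙-≟ {suc n} 0F       = cong suc (trans (sum-const n 0) (*-zeroʳ n))
sum-𝟙-≟ {suc n} (sucF a) = trans (sum-cong-≗ (λ l → cong 𝟙 (≟-suc a l))) (sum-𝟙-≟ a)
  where
  ≟-suc : ∀ {n} (a l : Fin n) → ⌊ sucF a ≟F sucF l ⌋ ≡ ⌊ a ≟F l ⌋
  ≟-suc a l with a ≟F l
  ... | yes _ = refl
  ... | no  _ = refl

list-sum-allFin : ∀ {n} (f : Fin n → ℕ) → List.sum (map f (allFin n)) ≡ sum f
list-sum-allFin {n} f = trans (cong List.sum (map-tabulate (λ i → i) f)) (sum-tabulate f)
  where
  sum-tabulate : ∀ {n} (f : Fin n → ℕ) → List.sum (tabulate f) ≡ sum f
  sum-tabulate {zero}  f = refl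
  sum-tabulate {suc n} f = cong (_+_ (f 0F)) (sum-tabulate (f ∘ sucF))

count≡sum : ∀ {n} (p : Fin n → Bool) → count p ≡ ∑[ i < n ] 𝟙 (p i)
count≡sum p = list-sum-allFin (𝟙 ∘ p)

count-+ : ∀ {n} (p q : Fin n → Bool) → count p + count q ≡ ∑[ i < n ] (𝟙 (p i) + 𝟙 (q i))
count-+ p q = trans (cong₂ _+_ (count≡sum p) (count≡sum q)) (sym (∑-distrib-+ (𝟙 ∘ p) (𝟙 ∘ q)))

count-const : ∀ n b → count {n} (λ _ → b) ≡ n * 𝟙 b
count-const n b = trans (count≡sum {n} (λ _ → b)) (sum-const n (𝟙 b))

count-mono : ∀ {n} {p q : Fin n → Bool} → (∀ i → p i ≡ true → q i ≡ true) → count p ≤ count q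
count-mono {p = p} {q} p⇒q =
  subst₂ _≤_ (sym (count≡sum p)) (sym (count≡sum q)) (sum-mono-≤ (λ i → 𝟙-mono (p⇒q i)))
  where
  𝟙-mono : ∀ {b c} → (b ≡ true → c ≡ true) → 𝟙 b ≤ 𝟙 c
  𝟙-mono {false} _   = z≤n
  𝟙-mono {true}  b⇒c rewrite b⇒c refl = ≤-refl

count-≤-+ : ∀ {n} (p q r : Fin n → Bool) → (∀ i → 𝟙 (p i) ≤ 𝟙 (q i) + 𝟙 (r i)) →
            count p ≤ count q + count r
count-≤-+ p q r le = begin
  count p                                 ≡⟨ count≡sum p ⟩
  sum (𝟙 ∘ p)                             ≤⟨ sum-mono-≤ le ⟩
  sum (λ i → 𝟙 (q i) + 𝟙 (r i))           ≡⟨ count-+ q r ⟨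
  count q + count r                       ∎
  where open ≤-Reasoning

count-+-≤-+ : ∀ {n} (p q r s : Fin n → Bool) → (∀ i → 𝟙 (p i) + 𝟙 (q i) ≤ 𝟙 (r i) + 𝟙 (s i)) →
              count p + count q ≤ count r + count s
count-+-≤-+ p q r s le = begin
  count p + count q                       ≡⟨ count-+ p q ⟩
  sum (λ i → 𝟙 (p i) + 𝟙 (q i))           ≤⟨ sum-mono-≤ le ⟩
  sum (λ i → 𝟙 (r i) + 𝟙 (s i))           ≡⟨ count-+ r s ⟨
  count r + count s                       ∎
  where open ≤-Reasoning

count-split : ∀ {n} (p q : Fin n → Bool) →
              count p ≡ count (λ i → p i ∧ q i) + count (λ i → p i ∧ not (q i))
count-split p q = trans (count≡sum p) (trans (sum-cong-≗ (λ i → 𝟙-split (p i) (q i))) (sym (count-+ (λ i → p i ∧ q i) (λ i → p i ∧ not (q i)))))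
  where
  𝟙-split : ∀ b c → 𝟙 b ≡ 𝟙 (b ∧ c) + 𝟙 (b ∧ not c)
  𝟙-split false c     = refl
  𝟙-split true  true  = refl
  𝟙-split true  false = refl

count-none : ∀ {n} (p : Fin n → Bool) → (∀ i → p i ≡ false) → count p ≡ 0
count-none {n} p none = trans (count≡sum p) (trans (sum-cong-≗ (cong 𝟙 ∘ none)) (trans (sum-const n 0) (*-zeroʳ n)))

count-witness : ∀ {n} (p : Fin n → Bool) → 0 < count p → ∃[ i ] p i ≡ true
count-witness p pos with sum-witness (𝟙 ∘ p) (subst (0 <_) (count≡sum p) pos)
... | i , 𝟙pi>0 = i , 𝟙-pos (p i) 𝟙pi>0
  where
  𝟙-pos : ∀ b → 0 < 𝟙 b → b ≡ true
  𝟙-pos true _ = refl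

count≡0⊎witness : ∀ {n} (p : Fin n → Bool) → count p ≡ 0 ⊎ ∃[ i ] p i ≡ true
count≡0⊎witness p with count p in eq
... | zero  = inj₁ refl
... | suc _ = inj₂ (count-witness p (subst (0 <_) (sym eq) (s≤s z≤n)))

≤-count : ∀ {n} (p : Fin n → Bool) i → 𝟙 (p i) ≤ count p
≤-count p i = subst (𝟙 (p i) ≤_) (sym (count≡sum p)) (≤-sum (𝟙 ∘ p) i)

count-≟ : ∀ {n} (a : Fin n) → count (λ l → ⌊ a ≟F l ⌋) ≡ 1
count-≟ a = trans (count≡sum (λ l → ⌊ a ≟F l ⌋)) (sum-𝟙-≟ a)

count-partition : ∀ {n R} (part : Fin n → Fin R) (p : Fin n → Bool) →
                  count p ≡ ∑[ l < R ] count (λ v → p v ∧ inPart part l v)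
count-partition {n} {R} part p = begin
  count p                                              ≡⟨ count≡sum p ⟩
  ∑[ v < n ] 𝟙 (p v)                                   ≡⟨ sum-cong-≗ 𝟙≡sum ⟩
  ∑[ v < n ] ∑[ l < R ] 𝟙 (p v ∧ inPart part l v)      ≡⟨ ∑-comm (λ v l → 𝟙 (p v ∧ inPart part l v)) ⟩
  ∑[ l < R ] ∑[ v < n ] 𝟙 (p v ∧ inPart part l v)      ≡⟨ sum-cong-≗ (λ l → sym (count≡sum (λ v → p v ∧ inPart part l v))) ⟩
  ∑[ l < R ] count (λ v → p v ∧ inPart part l v)       ∎
  where
  open ≡-Reasoning
  𝟙≡sum : ∀ v → 𝟙 (p v) ≡ ∑[ l < R ] 𝟙 (p v ∧ inPart part l v)
  𝟙≡sum v with p v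
  ... | true  = sym (sum-𝟙-≟ (part v))
  ... | false = sym (trans (sum-const R 0) (*-zeroʳ R))

∧-elim-middle : ∀ a b {c} → (a ∧ b) ∧ c ≡ true → a ∧ c ≡ true
∧-elim-middle true true abc = abc

exists-avoiding : ∀ {n m} (p : Fin n → Bool) (q : Fin m → Fin n → Bool) →
                  ∑[ a < m ] count (λ y → p y ∧ not (q a y)) < count p →
                  ∃[ y ] p y ≡ true × (∀ a → q a y ≡ true)
exists-avoiding {m = zero} p q few with count-witness p few
... | y , py = y , py , λ ()
exists-avoiding {m = suc m} p q few with exists-avoiding (λ y → p y ∧ q 0F y) (q ∘ sucF) fewer
  where
  p₀ p₁ : Fin _ → Bool
  p₀ y = p y ∧ q 0F y
  p₁ y = p y ∧ not (q 0F y)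
  fewer : ∑[ a < m ] count (λ y → p₀ y ∧ not (q (sucF a) y)) < count p₀
  fewer = +-cancelˡ-< (count p₁) _ _ (begin-strict
    count p₁ + ∑[ a < m ] count (λ y → p₀ y ∧ not (q (sucF a) y))
      ≤⟨ +-monoʳ-≤ (count p₁) (sum-mono-≤ (λ a → count-mono {p = λ y → p₀ y ∧ not (q (sucF a) y)} (λ y → ∧-elim-middle (p y) (q 0F y)))) ⟩
    count p₁ + ∑[ a < m ] count (λ y → p y ∧ not (q (sucF a) y))
      <⟨ few ⟩
    count p
      ≡⟨ trans (count-split p (q 0F)) (+-comm (count p₀) (count p₁)) ⟩
    count p₁ + count p₀ ∎)
    where
    open ≤-Reasoning
... | y , p₀y , qy = y , ∧-conicalˡ _ _ p₀y , λ { 0F → ∧-conicalʳ _ _ p₀y ; (sucF a) → qy a }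

-- Symmetric relations and graphs

module _ {n} (q : Fin n → Fin n → Bool) (q-sym : ∀ u v → q u v ≡ q v u) (q-irrefl : ∀ v → q v v ≡ false) where

  private
    before : Fin n → Fin n → Bool
    before v u = (toℕ v <ᵇ toℕ u) ∧ q v u

    𝟙-split-by-order : ∀ v u → 𝟙 (q v u) ≡ 𝟙 (before v u) + 𝟙 (before u v)
    𝟙-split-by-order v u with toℕ v <ᵇ toℕ u in v<u | toℕ u <ᵇ toℕ v in u<v
    ... | true  | true  = ⊥-elim (<-asym (<ᵇ⇒< (toℕ v) (toℕ u) (subst T (sym v<u) _)) (<ᵇ⇒< (toℕ u) (toℕ v) (subst T (sym u<v) _)))
    ... | true  | false = sym (+-identityʳ _)
    ... | false | true  = cong 𝟙 (q-sym v u)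
    ... | false | false = cong 𝟙 (subst (λ z → q v z ≡ false) v≡u (q-irrefl v))
      where
      v≡u : v ≡ u
      v≡u = toℕ-injective (≤-antisym (≮⇒≥ (λ u<v′ → subst T u<v (<⇒<ᵇ u<v′)))
                                     (≮⇒≥ (λ v<u′ → subst T v<u (<⇒<ᵇ v<u′))))

    ∑before : ℕ
    ∑before = ∑[ v < n ] ∑[ u < n ] 𝟙 (before v u)

    countPairs≡∑before : countPairs q ≡ ∑before
    countPairs≡∑before = trans (list-sum-allFin (λ v → count (before v))) (sum-cong-≗ (λ v → count≡sum (before v)))

  handshake : ∑[ v < n ] count (q v) ≡ 2 * countPairs q
  handshake = begin
    ∑[ v < n ] count (q v)
      ≡⟨ sum-cong-≗ (λ v → trans (count≡sum (q v)) (sum-cong-≗ (𝟙-split-by-order v))) ⟩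
    ∑[ v < n ] ∑[ u < n ] (𝟙 (before v u) + 𝟙 (before u v))
      ≡⟨ sum-cong-≗ (λ v → ∑-distrib-+ (λ u → 𝟙 (before v u)) (λ u → 𝟙 (before u v))) ⟩
    ∑[ v < n ] (∑[ u < n ] 𝟙 (before v u) + ∑[ u < n ] 𝟙 (before u v))
      ≡⟨ ∑-distrib-+ (λ v → ∑[ u < n ] 𝟙 (before v u)) (λ v → ∑[ u < n ] 𝟙 (before u v)) ⟩
    ∑before + ∑[ v < n ] ∑[ u < n ] 𝟙 (before u v)
      ≡⟨ cong (_+_ ∑before) (∑-comm (λ v u → 𝟙 (before u v))) ⟩
    ∑before + ∑before
      ≡⟨ cong (_+_ ∑before) (sym (+-identityʳ ∑before)) ⟩
    2 * ∑before
      ≡⟨ cong (_*_ 2) countPairs≡∑before ⟨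
    2 * countPairs q ∎
    where open ≡-Reasoning

nonDeg : ∀ {n} → Graph n → Fin n → ℕ
nonDeg G v = count (λ u → not (adj G v u))

deg+nonDeg≡n : ∀ {n} (G : Graph n) v → deg G v + nonDeg G v ≡ n
deg+nonDeg≡n {n} G v = trans (sym (count-split (λ _ → true) (adj G v))) (trans (count-const n true) (*-identityʳ n))

insideAdj : ∀ {n} → Graph n → (Fin n → Bool) → Fin n → Fin n → Bool
insideAdj G A u v = A u ∧ A v ∧ adj G u v

nonIsolatedIn : ∀ {n} → Graph n → (Fin n → Bool) → Fin n → Bool
nonIsolatedIn G A v = A v ∧ (0 <ᵇ degIn G A v)

module _ {n} (G : Graph n) (A : Fin n → Bool) where

  sum-degIn≡2*edgesIn : ∑[ v < n ] count (insideAdj G A v) ≡ 2 * edgesIn G A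
  sum-degIn≡2*edgesIn = handshake (insideAdj G A) insideAdj-sym insideAdj-irrefl
    where
    insideAdj-sym : ∀ u v → insideAdj G A u v ≡ insideAdj G A v u
    insideAdj-sym u v rewrite adj-sym G u v with A u | A v
    ... | true  | true  = refl
    ... | true  | false = refl
    ... | false | true  = refl
    ... | false | false = refl
    insideAdj-irrefl : ∀ v → insideAdj G A v v ≡ false
    insideAdj-irrefl v rewrite adj-irrefl G v with A v
    ... | true  = refl
    ... | false = refl

  degIn≤2*edgesIn : ∀ x → A x ≡ true → degIn G A x ≤ 2 * edgesIn G A
  degIn≤2*edgesIn x Ax = begin
    degIn G A x                        ≡⟨ cong (λ b → count (λ u → b ∧ A u ∧ adj G x u)) Ax ⟨
    count (insideAdj G A x)            ≤⟨ ≤-sum (λ v → count (insideAdj G A v)) x ⟩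
    ∑[ v < n ] count (insideAdj G A v) ≡⟨ sum-degIn≡2*edgesIn ⟩
    2 * edgesIn G A                    ∎
    where open ≤-Reasoning

  count-nonIsolatedIn≤2*edgesIn : count (nonIsolatedIn G A) ≤ 2 * edgesIn G A
  count-nonIsolatedIn≤2*edgesIn = begin
    count (nonIsolatedIn G A)          ≡⟨ count≡sum (nonIsolatedIn G A) ⟩
    sum (𝟙 ∘ nonIsolatedIn G A)        ≤⟨ sum-mono-≤ 𝟙≤degIn ⟩
    ∑[ v < n ] count (insideAdj G A v) ≡⟨ sum-degIn≡2*edgesIn ⟩
    2 * edgesIn G A                    ∎
    where
    open ≤-Reasoning
    𝟙≤degIn : ∀ v → 𝟙 (nonIsolatedIn G A v) ≤ count (insideAdj G A v)
    𝟙≤degIn v with A v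
    ... | false = z≤n
    ... | true with degIn G A v
    ...   | zero  = z≤n
    ...   | suc _ = s≤s z≤n

  isolatedIn⇒nbrs-outside : ∀ u z → degIn G A u ≡ 0 → adj G u z ≡ true → A z ≡ false
  isolatedIn⇒nbrs-outside u z isolated uz = ¬-not λ Az →
    n≮0 (subst₂ _≤_ (cong₂ (λ a b → 𝟙 (a ∧ b)) Az uz) isolated (≤-count (λ t → A t ∧ adj G u t) z))

adj-flip : ∀ {n} (G : Graph n) {x z} → adj G x z ≡ true → adj G z x ≡ true
adj-flip G {x} {z} xz = trans (adj-sym G z x) xz

adj⇒≢ : ∀ {n} (G : Graph n) {x z} → adj G x z ≡ true → x ≢ z
adj⇒≢ G {x} xz refl with trans (sym (adj-irrefl G x)) xz
... | ()

addEdge-cases : ∀ {n} (h : Fin n → Fin n → Bool) u w x z → addEdge h u w x z ≡ true →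
                h x z ≡ true ⊎ (x ≡ u × z ≡ w) ⊎ (x ≡ w × z ≡ u)
addEdge-cases h u w x z e with h x z | x ≟F u | z ≟F w | x ≟F w | z ≟F u
... | true  | _     | _     | _     | _     = inj₁ refl
... | false | yes p | yes q | _     | _     = inj₂ (inj₁ (p , q))
... | false | _     | _     | yes p | yes q = inj₂ (inj₂ (p , q))
addEdge-cases h u w x z () | false | no _  | _    | no _  | _
addEdge-cases h u w x z () | false | no _  | _    | yes _ | no _
addEdge-cases h u w x z () | false | yes _ | no _ | no _  | _
addEdge-cases h u w x z () | false | yes _ | no _ | yes _ | no _

redirect : ∀ {k n} (F : Graph k) (G : Graph n) {u w} (y : Fin n) (φ : Fin k → Fin n) →
           Injective _≡_ _≡_ φ →
           (∀ a b → adj F a b ≡ true → addEdge (adj G) u w (φ a) (φ b) ≡ true) →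
           (∀ a → φ a ≢ y) → adj G w y ≡ true →
           (∀ a → adj G u (φ a) ≡ true → adj G (φ a) y ≡ true) →
           Contains F G
redirect {k} {n} F G {u} {w} y φ φ-inj φ-emb y-fresh wy u~φ⇒φ~y = ψφ , ψφ-inj , ψφ-emb
  where
  ψφ : Fin k → Fin n
  ψφ a = if ⌊ φ a ≟F u ⌋ then y else φ a

  ψφ-inj : Injective _≡_ _≡_ ψφ
  ψφ-inj {a} {b} eq with φ a ≟F u | φ b ≟F u
  ... | yes p | yes q = φ-inj (trans p (sym q))
  ... | yes _ | no  _ = ⊥-elim (y-fresh b (sym eq))
  ... | no  _ | yes _ = ⊥-elim (y-fresh a eq)
  ... | no  _ | no  _ = φ-inj eq

  ψφ-emb : ∀ a b → adj F a b ≡ true → adj G (ψφ a) (ψφ b) ≡ true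
  ψφ-emb a b ab with φ a ≟F u | φ b ≟F u | addEdge-cases (adj G) u w (φ a) (φ b) (φ-emb a b ab)
  ... | yes p | yes q | _                     = ⊥-elim (adj⇒≢ F ab (φ-inj (trans p (sym q))))
  ... | yes p | no  _ | inj₁ φa~φb            = adj-flip G (u~φ⇒φ~y b (subst (λ z → adj G z (φ b) ≡ true) p φa~φb))
  ... | yes _ | no  _ | inj₂ (inj₁ (_ , φb≡w)) = adj-flip G (subst (λ z → adj G z y ≡ true) (sym φb≡w) wy)
  ... | yes _ | no  q | inj₂ (inj₂ (_ , φb≡u)) = ⊥-elim (q φb≡u)
  ... | no  _ | yes q | inj₁ φa~φb            = u~φ⇒φ~y a (adj-flip G (subst (λ z → adj G (φ a) z ≡ true) q φa~φb))
  ... | no  p | yes _ | inj₂ (inj₁ (φa≡u , _)) = ⊥-elim (p φa≡u)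
  ... | no  _ | yes _ | inj₂ (inj₂ (φa≡w , _)) = subst (λ z → adj G z y ≡ true) (sym φa≡w) wy
  ... | no  _ | no  _ | inj₁ φa~φb            = φa~φb
  ... | no  p | no  _ | inj₂ (inj₁ (φa≡u , _)) = ⊥-elim (p φa≡u)
  ... | no  _ | no  q | inj₂ (inj₂ (_ , φb≡u)) = ⊥-elim (q φb≡u)

-- Partitions with sparse parts

inPart-own : ∀ {n r} (part : Fin n → Fin r) v → inPart part (part v) v ≡ true
inPart-own part v with part v ≟F part v
... | yes _  = refl
... | no  ne = ⊥-elim (ne refl)

inPart⇒≡ : ∀ {n r} (part : Fin n → Fin r) {i v} → inPart part i v ≡ true → part v ≡ i
inPart⇒≡ part {i} {v} h with part v ≟F i
inPart⇒≡ part {i} {v} h  | yes pv≡i = pv≡i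
inPart⇒≡ part {i} {v} () | no  _

inPart-other : ∀ {n r} (part : Fin n → Fin r) {u v} → part u ≢ part v → inPart part (part u) v ≡ false
inPart-other part {u} {v} pu≢pv with part v ≟F part u
... | yes pv≡pu = ⊥-elim (pu≢pv (sym pv≡pu))
... | no  _     = refl

module SparseParts {n r} (G : Graph n) (part : Fin n → Fin (suc r)) {c : ℕ}
                   (sparse : ∀ i → edgesIn G (inPart part i) ≤ c) where

  V : Fin (suc r) → Fin n → Bool
  V = inPart part

  degIn-own≤2c : ∀ x → degIn G (V (part x)) x ≤ 2 * c
  degIn-own≤2c x = ≤-trans (degIn≤2*edgesIn G (V (part x)) x (inPart-own part x)) (*-monoʳ-≤ 2 (sparse (part x)))

  BComplete : Set
  BComplete = ∀ i u w → V i u ≡ true → degIn G (V i) u ≡ 0 → V i w ≡ false → adj G u w ≡ true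

  inA : Fin n → Bool
  inA v = nonIsolatedIn G (V (part v)) v

  private
    inA∧V⇒nonIsolated : ∀ l v → (inA v ∧ V l v) ≡ true → nonIsolatedIn G (V l) v ≡ true
    inA∧V⇒nonIsolated l v h with inPart⇒≡ part (∧-conicalʳ _ _ h)
    ... | refl = ∧-conicalˡ _ _ h

    isolated⊎inA : ∀ u → degIn G (V (part u)) u ≡ 0 ⊎ inA u ≡ true
    isolated⊎inA u with degIn G (V (part u)) u
    ... | zero  = inj₁ refl
    ... | suc _ = inj₂ (cong (_∧ true) (inPart-own part u))

  sizeA≤2c : ∀ i → sizeA G part i ≤ 2 * c
  sizeA≤2c i = ≤-trans (count-nonIsolatedIn≤2*edgesIn G (V i)) (*-monoʳ-≤ 2 (sparse i))

  count-inA∧V≤2c : ∀ l → count (λ v → inA v ∧ V l v) ≤ 2 * c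
  count-inA∧V≤2c l = ≤-trans (count-mono (inA∧V⇒nonIsolated l)) (sizeA≤2c l)

  count-inA≤ : count inA ≤ suc r * (2 * c)
  count-inA≤ = subst (_≤ suc r * (2 * c)) (sym (count-partition part inA))
                     (sum-≤-const (λ l → count (λ v → inA v ∧ V l v)) count-inA∧V≤2c)

  count-inA-outside≤ : ∀ j → count (λ v → inA v ∧ not (V j v)) ≤ r * (2 * c)
  count-inA-outside≤ j = begin
    count (λ v → inA v ∧ not (V j v))   ≡⟨ count-partition part (λ v → inA v ∧ not (V j v)) ⟩
    ∑[ l < suc r ] f l                  ≤⟨ sum-≤-except f j (λ l _ → ≤-trans (count-mono (λ v → ∧-elim-middle (inA v) _)) (count-inA∧V≤2c l)) ⟩
    f j + r * (2 * c)                   ≡⟨ cong (_+ r * (2 * c)) (count-none _ (λ v → excluded (inA v) (V j v))) ⟩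
    r * (2 * c)                         ∎
    where
    open ≤-Reasoning
    f : Fin (suc r) → ℕ
    f l = count (λ v → (inA v ∧ not (V j v)) ∧ V l v)
    excluded : ∀ a b → (a ∧ not b) ∧ b ≡ false
    excluded false b     = refl
    excluded true  true  = refl
    excluded true  false = refl

  outAdj : Fin n → Fin n → Bool
  outAdj u v = not ⌊ part u ≟F part v ⌋ ∧ not (adj G u v)

  private
    outAdj-sym : ∀ u v → outAdj u v ≡ outAdj v u
    outAdj-sym u v rewrite adj-sym G u v with part u ≟F part v | part v ≟F part u
    ... | yes _  | yes _  = refl
    ... | no  _  | no  _  = refl
    ... | yes pu≡pv | no pv≢pu = ⊥-elim (pv≢pu (sym pu≡pv))
    ... | no pu≢pv | yes pv≡pu = ⊥-elim (pu≢pv (sym pv≡pu))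

    outAdj-irrefl : ∀ v → outAdj v v ≡ false
    outAdj-irrefl v with part v ≟F part v
    ... | yes _  = refl
    ... | no  ne = ⊥-elim (ne refl)

    outAdj-split : ∀ {u v} → outAdj u v ≡ true → part u ≢ part v × adj G u v ≡ false
    outAdj-split {u} {v} h with part u ≟F part v | adj G u v
    outAdj-split () | yes _ | _
    outAdj-split h  | no pu≢pv | false = pu≢pv , refl

    outAdj⇒inA : BComplete → ∀ u v → outAdj u v ≡ true → inA u ≡ true
    outAdj⇒inA complete u v h with isolated⊎inA u | outAdj-split h
    ... | inj₂ Au  | _ = Au
    ... | inj₁ iso | pu≢pv , uv = ⊥-elim (true≢false (trans (sym (complete (part u) u v (inPart-own part u) iso (inPart-other part pu≢pv))) uv))

    degOut≤ : BComplete → ∀ u → count (outAdj u) ≤ 𝟙 (inA u) * (r * (2 * c))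
    degOut≤ complete u with inA u in Au
    ... | false = ≤-reflexive (count-none (outAdj u) (λ v → ¬-not (λ h → true≢false (trans (sym (outAdj⇒inA complete u v h)) Au))))
    ... | true  = subst (count (outAdj u) ≤_) (sym (+-identityʳ _)) (≤-trans (count-mono inA-outside) (count-inA-outside≤ (part u)))
      where
      inA-outside : ∀ v → outAdj u v ≡ true → (inA v ∧ not (V (part u) v)) ≡ true
      inA-outside v h = cong₂ (λ a b → a ∧ not b) (outAdj⇒inA complete v u (trans (outAdj-sym v u) h))
                                                 (inPart-other part (proj₁ (outAdj-split h)))

  edgesOut≤ : BComplete → edgesOut G part ≤ 2 * r * suc r * (c * c)
  edgesOut≤ complete = *-cancelˡ-≤ 2 (begin
    2 * edgesOut G part                     ≡⟨ handshake outAdj outAdj-sym outAdj-irrefl ⟨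
    ∑[ u < n ] count (outAdj u)             ≤⟨ sum-mono-≤ (degOut≤ complete) ⟩
    ∑[ u < n ] (𝟙 (inA u) * K)              ≡⟨ *-distribʳ-sum K (𝟙 ∘ inA) ⟨
    sum (𝟙 ∘ inA) * K                       ≡⟨ cong (_* K) (count≡sum inA) ⟨
    count inA * K                           ≤⟨ *-monoˡ-≤ K count-inA≤ ⟩
    suc r * (2 * c) * (r * (2 * c))         ≡⟨ regroup r c ⟩
    2 * (2 * r * suc r * (c * c))           ∎)
    where
    open ≤-Reasoning
    K = r * (2 * c)
    regroup : ∀ r c → suc r * (2 * c) * (r * (2 * c)) ≡ 2 * (2 * r * suc r * (c * c))
    regroup = solve-∀

  module AlmostTuran {L P : ℕ} (fewNonNbrs : ∀ v → L * nonDeg G v ≤ P * n) where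

    partBound : ℕ
    partBound = P * n + L * (2 * c)

    -- the non-neighbours of x in V i, except that there are none when x itself lies in V i
    missed : Fin (suc r) → Fin n → ℕ
    missed i x = count (λ y → V i y ∧ not (V i x ∨ adj G x y))

    missed+part≤ : ∀ i x → missed i x + count (V (part x)) ≤ nonDeg G x + 2 * c
    missed+part≤ i x = begin
      missed i x + count (V j)       ≤⟨ count-+-≤-+ (λ y → V i y ∧ not (V i x ∨ adj G x y)) (V j)
                                                    (λ y → not (adj G x y)) (λ y → V j y ∧ adj G x y)
                                                    (λ y → 𝟙-bound (V i y) (V i x) (V j y) (adj G x y) (shared y)) ⟩
      nonDeg G x + degIn G (V j) x   ≤⟨ +-monoʳ-≤ (nonDeg G x) (degIn-own≤2c x) ⟩
      nonDeg G x + 2 * c             ∎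
      where
      open ≤-Reasoning
      j = part x
      shared : ∀ y → V i y ∧ V j y ≡ true → V i x ≡ true
      shared y h = subst (λ l → V l x ≡ true)
                         (trans (sym (inPart⇒≡ part (∧-conicalʳ _ _ h))) (inPart⇒≡ part (∧-conicalˡ _ _ h)))
                         (inPart-own part x)
      𝟙-bound : ∀ a b d e → (a ∧ d ≡ true → b ≡ true) → 𝟙 (a ∧ not (b ∨ e)) + 𝟙 d ≤ 𝟙 (not e) + 𝟙 (d ∧ e)
      𝟙-bound false _     false _     _ = z≤n
      𝟙-bound false _     true  true  _ = ≤-refl
      𝟙-bound false _     true  false _ = ≤-refl
      𝟙-bound true  true  false _     _ = z≤n
      𝟙-bound true  true  true  true  _ = ≤-refl
      𝟙-bound true  true  true  false _ = ≤-refl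
      𝟙-bound true  false false true  _ = z≤n
      𝟙-bound true  false true  true  _ = ≤-refl
      𝟙-bound true  false false false _ = ≤-refl
      𝟙-bound true  false true  false h = ⊥-elim (true≢false (sym (h refl)))

    L*[missed+part]≤ : ∀ i x → L * (missed i x + count (V (part x))) ≤ partBound
    L*[missed+part]≤ i x = begin
      L * (missed i x + count (V (part x)))  ≤⟨ *-monoʳ-≤ L (missed+part≤ i x) ⟩
      L * (nonDeg G x + 2 * c)               ≡⟨ *-distribˡ-+ L (nonDeg G x) (2 * c) ⟩
      L * nonDeg G x + L * (2 * c)           ≤⟨ +-monoˡ-≤ (L * (2 * c)) (fewNonNbrs x) ⟩
      partBound                              ∎
      where open ≤-Reasoning

    L*part≤ : ∀ l → L * count (V l) ≤ partBound
    L*part≤ l with count≡0⊎witness (V l)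
    ... | inj₁ empty = subst (_≤ partBound) (sym (trans (cong (_*_ L) empty) (*-zeroʳ L))) z≤n
    ... | inj₂ (x , lx) with inPart⇒≡ part lx
    ...   | refl = ≤-trans (*-monoʳ-≤ L (m≤n+m _ (missed l x))) (L*[missed+part]≤ l x)

    L*n≤ : ∀ j → L * n ≤ L * count (V j) + r * partBound
    L*n≤ j = begin
      L * n                                  ≡⟨ cong (_*_ L) n≡∑ ⟩
      L * ∑[ l < suc r ] count (V l)         ≡⟨ *-distribˡ-sum L (λ l → count (V l)) ⟩
      ∑[ l < suc r ] (L * count (V l)) ≤⟨ sum-≤-except (λ l → L * count (V l)) j (λ l _ → L*part≤ l) ⟩
      L * count (V j) + r * partBound        ∎
      where
      open ≤-Reasoning
      n≡∑ : n ≡ ∑[ l < suc r ] count (V l)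
      n≡∑ = trans (sym (trans (count-const n true) (*-identityʳ n))) (count-partition part (λ _ → true))

    L*missed+L*n≤ : ∀ i x → L * missed i x + L * n ≤ suc r * partBound
    L*missed+L*n≤ i x = begin
      L * missed i x + L * n                                 ≤⟨ +-monoʳ-≤ (L * missed i x) (L*n≤ (part x)) ⟩
      L * missed i x + (L * count (V (part x)) + r * partBound) ≡⟨ +-assoc (L * missed i x) _ _ ⟨
      L * missed i x + L * count (V (part x)) + r * partBound ≡⟨ cong (_+ r * partBound) (*-distribˡ-+ L _ _) ⟨
      L * (missed i x + count (V (part x))) + r * partBound  ≤⟨ +-monoˡ-≤ (r * partBound) (L*[missed+part]≤ i x) ⟩
      suc r * partBound                                      ∎
      where open ≤-Reasoning

    module _ {m : ℕ} (large : L * m + (m * suc r + r) * partBound < suc m * (L * n)) where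

      ∑suc-missed< : ∀ i (x : Fin m → Fin n) → ∑[ a < m ] suc (missed i (x a)) < count (V i)
      ∑suc-missed< i x = *-cancelˡ-< L _ _ (+-cancelʳ-< (m * (L * n) + r * B) _ _ (begin-strict
        L * S + (m * (L * n) + r * B)            ≡⟨ +-assoc (L * S) _ _ ⟨
        L * S + m * (L * n) + r * B              ≤⟨ +-monoˡ-≤ (r * B) L*S+m*L*n≤ ⟩
        m * (L + suc r * B) + r * B              ≡⟨ regroup m L r B ⟩
        L * m + (m * suc r + r) * B              <⟨ large ⟩
        L * n + m * (L * n)                      ≤⟨ +-monoˡ-≤ (m * (L * n)) (L*n≤ i) ⟩
        L * count (V i) + r * B + m * (L * n)    ≡⟨ shuffle (L * count (V i)) (r * B) (m * (L * n)) ⟩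
        L * count (V i) + (m * (L * n) + r * B)  ∎))
        where
        open ≤-Reasoning
        B = partBound
        S = ∑[ a < m ] suc (missed i (x a))
        regroup : ∀ m L r B → m * (L + suc r * B) + r * B ≡ L * m + (m * suc r + r) * B
        regroup = solve-∀
        shuffle : ∀ a b d → a + b + d ≡ a + (d + b)
        shuffle = solve-∀
        L*S+m*L*n≤ : L * S + m * (L * n) ≤ m * (L + suc r * B)
        L*S+m*L*n≤ = begin
          L * S + m * (L * n)
            ≡⟨ cong₂ _+_ (*-distribˡ-sum L (λ a → suc (missed i (x a)))) (sym (sum-const m (L * n))) ⟩
          ∑[ a < m ] (L * suc (missed i (x a))) + ∑[ a < m ] (L * n)
            ≡⟨ ∑-distrib-+ (λ a → L * suc (missed i (x a))) (λ _ → L * n) ⟨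
          ∑[ a < m ] (L * suc (missed i (x a)) + L * n)
            ≤⟨ sum-mono-≤ (λ a → ≤-trans (≤-reflexive (trans (cong (_+ L * n) (*-suc L _)) (+-assoc L _ _)))
                                         (+-monoʳ-≤ L (L*missed+L*n≤ i (x a)))) ⟩
          ∑[ a < m ] (L + suc r * B)
            ≡⟨ sum-const m (L + suc r * B) ⟩
          m * (L + suc r * B) ∎

      common-neighbour : ∀ i (x : Fin m → Fin n) →
                         ∃[ y ] V i y ≡ true × (∀ a → x a ≢ y) × (∀ a → V i (x a) ≡ false → adj G (x a) y ≡ true)
      common-neighbour i x with exists-avoiding (V i) attached (≤-<-trans (sum-mono-≤ unattached≤) (∑suc-missed< i x))
        where
        attached : Fin m → Fin n → Bool
        attached a y = not ⌊ x a ≟F y ⌋ ∧ (V i (x a) ∨ adj G (x a) y)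
        unattached≤ : ∀ a → count (λ y → V i y ∧ not (attached a y)) ≤ suc (missed i (x a))
        unattached≤ a = subst (count (λ y → V i y ∧ not (attached a y)) ≤_) (cong (_+ missed i (x a)) (count-≟ (x a)))
          (count-≤-+ _ (λ y → ⌊ x a ≟F y ⌋) (λ y → V i y ∧ not (V i (x a) ∨ adj G (x a) y))
                     (λ y → 𝟙-bound (V i y) ⌊ x a ≟F y ⌋ (V i (x a) ∨ adj G (x a) y)))
          where
          𝟙-bound : ∀ v e b → 𝟙 (v ∧ not (not e ∧ b)) ≤ 𝟙 e + 𝟙 (v ∧ not b)
          𝟙-bound false e     b     = z≤n
          𝟙-bound true  true  b     = s≤s z≤n
          𝟙-bound true  false true  = z≤n
          𝟙-bound true  false false = ≤-refl
      ... | y , iy , attached-y = y , iy , fresh , outside~y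
        where
        fresh : ∀ a → x a ≢ y
        fresh a xa≡y with x a ≟F y | attached-y a
        ... | yes _ | ()
        ... | no xa≢y | _ = xa≢y xa≡y
        outside~y : ∀ a → V i (x a) ≡ false → adj G (x a) y ≡ true
        outside~y a out with x a ≟F y | attached-y a
        ... | yes _ | ()
        ... | no _  | xa~y rewrite out = xa~y

    saturated⇒BComplete : ∀ {k} {F : Graph k} → Saturated F G →
                          L * suc k + (suc k * suc r + r) * partBound < suc (suc k) * (L * n) → BComplete
    saturated⇒BComplete {F = F} (F-free , saturating) large i u w iu u-isolated wo = ¬-not (F-free ∘ F⊆G)
      where
      F⊆G : adj G u w ≡ false → Contains F G
      F⊆G uw =
        let φ , φ-inj , φ-emb = saturating u w (λ u≡w → true≢false (trans (sym iu) (subst (λ z → V i z ≡ false) (sym u≡w) wo))) uw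
            y , _ , fresh , outside~y = common-neighbour large i (w ∷ φ)
        in redirect F G y φ φ-inj φ-emb (fresh ∘ sucF) (outside~y 0F wo)
                    (λ a uφa → outside~y (sucF a) (isolatedIn⇒nbrs-outside G (V i) u (φ a) u-isolated uφa))

-- The minimum-degree condition

degree-threshold : ∀ r₁ m₁ n d {ε : ℚ} → ε ℚ.< + 1 ℚ./ suc m₁ →
                   (1ℚ ℚ.- + 1 ℚ./ suc r₁ ℚ.- ε) ℚ.* (+ n ℚ./ 1) ℚ.< + d ℚ./ 1 →
                   suc r₁ * suc m₁ * n < suc r₁ * suc m₁ * d + (suc m₁ + suc r₁) * n
degree-threshold r₁ m₁ n d {ε} ε<1/M lower<d =
  ZP.drop‿+<+ (subst₂ ℤ._<_ lhs≡ rhs≡ (ZP.+-monoˡ-< ((+ M ℤ.+ + R) ℤ.* + n) cross))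
  where
  R = suc r₁
  M = suc m₁

  lower : ℚ → ℚ
  lower e = (1ℚ ℚ.- + 1 ℚ./ R ℚ.- e) ℚ.* (+ n ℚ./ 1)

  lowerᵘ : ℚᵘ
  lowerᵘ = (ᵘ.1ℚᵘ ᵘ.- mkℚᵘ (+ 1) r₁ ᵘ.- mkℚᵘ (+ 1) m₁) ᵘ.* mkℚᵘ (+ n) 0

  toℚᵘ-/ : ∀ a k → ℚ.toℚᵘ (+ a ℚ./ suc k) ᵘ.≃ mkℚᵘ (+ a) k
  toℚᵘ-/ a k = QP.toℚᵘ-fromℚᵘ (mkℚᵘ (+ a) k)

  toℚᵘ-lower : ℚ.toℚᵘ (lower (+ 1 ℚ./ M)) ᵘ.≃ lowerᵘ
  toℚᵘ-lower =
    UP.≃-trans (QP.toℚᵘ-homo-* (1ℚ ℚ.- + 1 ℚ./ R ℚ.- + 1 ℚ./ M) (+ n ℚ./ 1))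
      (UP.*-cong (UP.≃-trans (QP.toℚᵘ-homo-+ (1ℚ ℚ.- + 1 ℚ./ R) (ℚ.- (+ 1 ℚ./ M)))
                   (UP.+-cong (UP.≃-trans (QP.toℚᵘ-homo-+ 1ℚ (ℚ.- (+ 1 ℚ./ R)))
                                 (UP.+-cong (UP.≃-refl {ᵘ.1ℚᵘ}) (toℚᵘ-neg-/ r₁)))
                              (toℚᵘ-neg-/ m₁)))
                 (toℚᵘ-/ n 0))
    where
    toℚᵘ-neg-/ : ∀ k → ℚ.toℚᵘ (ℚ.- (+ 1 ℚ./ suc k)) ᵘ.≃ ᵘ.- mkℚᵘ (+ 1) k
    toℚᵘ-neg-/ k = UP.≃-trans (QP.toℚᵘ-homo‿- (+ 1 ℚ./ suc k)) (UP.-‿cong (toℚᵘ-/ 1 k))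

  lower-antitone : lower (+ 1 ℚ./ M) ℚ.≤ lower ε
  lower-antitone = QP.*-monoʳ-≤-nonNeg (+ n ℚ./ 1) {{QP.normalize-nonNeg n 1}}
                     (QP.+-monoʳ-≤ (1ℚ ℚ.- + 1 ℚ./ R) (QP.neg-antimono-≤ (QP.<⇒≤ ε<1/M)))

  lowerᵘ<d : lowerᵘ ᵘ.< mkℚᵘ (+ d) 0
  lowerᵘ<d = UP.<-respʳ-≃ (toℚᵘ-/ d 0)
               (UP.<-respˡ-≃ toℚᵘ-lower (QP.toℚᵘ-mono-< (QP.≤-<-trans lower-antitone lower<d)))

  cross : ᵘ.↥ lowerᵘ ℤ.* + 1 ℤ.< + d ℤ.* ᵘ.↧ lowerᵘ
  cross with lowerᵘ<d
  ... | ᵘ.*<* lt = lt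

  -- ↥ lowerᵘ and ↧ lowerᵘ unfold to the left-hand sides of these identities
  lhs-identity : ∀ (R M n : ℤ) →
    ((((+ 1) ℤ.* R ℤ.+ (ℤ.- + 1) ℤ.* (+ 1)) ℤ.* M ℤ.+ (ℤ.- + 1) ℤ.* ((+ 1) ℤ.* R)) ℤ.* n) ℤ.* + 1
      ℤ.+ (M ℤ.+ R) ℤ.* n ≡ R ℤ.* M ℤ.* n
  lhs-identity = ZS.solve-∀
  rhs-identity : ∀ (R M n d : ℤ) →
    d ℤ.* ((((+ 1) ℤ.* R) ℤ.* M) ℤ.* + 1) ℤ.+ (M ℤ.+ R) ℤ.* n ≡ R ℤ.* M ℤ.* d ℤ.+ (M ℤ.+ R) ℤ.* n
  rhs-identity = ZS.solve-∀

  pos-*³ : ∀ a b e → + (a * b * e) ≡ + a ℤ.* + b ℤ.* + e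
  pos-*³ a b e = trans (ZP.pos-* (a * b) e) (cong (ℤ._* + e) (ZP.pos-* a b))

  lhs≡ : ᵘ.↥ lowerᵘ ℤ.* + 1 ℤ.+ (+ M ℤ.+ + R) ℤ.* + n ≡ + (R * M * n)
  lhs≡ = trans (lhs-identity (+ R) (+ M) (+ n)) (sym (pos-*³ R M n))

  rhs≡ : + d ℤ.* ᵘ.↧ lowerᵘ ℤ.+ (+ M ℤ.+ + R) ℤ.* + n ≡ + (R * M * d + (M + R) * n)
  rhs≡ = trans (rhs-identity (+ R) (+ M) (+ n) (+ d))
           (sym (trans (ZP.pos-+ (R * M * d) _)
                       (cong₂ ℤ._+_ (pos-*³ R M d) (trans (ZP.pos-* (M + R) n) (cong (ℤ._* + n) (ZP.pos-+ M R))))))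

nonDeg-bound : ∀ {n} (G : Graph n) r₁ m₁ {ε : ℚ} → ε ℚ.< + 1 ℚ./ suc m₁ → ∀ v →
               (1ℚ ℚ.- + 1 ℚ./ suc r₁ ℚ.- ε) ℚ.* (+ n ℚ./ 1) ℚ.< + deg G v ℚ./ 1 →
               suc r₁ * suc m₁ * nonDeg G v ≤ (suc m₁ + suc r₁) * n
nonDeg-bound {n} G r₁ m₁ ε<1/M v degree =
  <⇒≤ (+-cancelˡ-< (L * deg G v) _ _
         (subst (_< L * deg G v + (suc m₁ + suc r₁) * n) L*n≡
                (degree-threshold r₁ m₁ n (deg G v) ε<1/M degree)))
  where
  L = suc r₁ * suc m₁
  L*n≡ : L * n ≡ L * deg G v + L * nonDeg G v
  L*n≡ = trans (cong (_*_ L) (sym (deg+nonDeg≡n G v))) (*-distribˡ-+ L (deg G v) (nonDeg G v))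

module TuranConstants (r₁ k c : ℕ) where

  R m M L P threshold : ℕ
  R = suc r₁
  m = suc k
  M = suc m * R * R
  L = R * M
  P = M + R
  threshold = L * m + (m * R + r₁) * (L * (2 * c))

  large : ∀ n → threshold < n → L * m + (m * R + r₁) * (P * n + L * (2 * c)) < suc m * (L * n)
  large n threshold<n = subst₂ _<_ (sym (split-constants L m R r₁ P n c)) (sym (margin m r₁ n))
                                  (+-monoʳ-< ((m * R + r₁) * (P * n)) (≤-trans threshold<n (m≤n*m n R)))
    where
    -- M is chosen so that (m + 1) L = (m R + r₁) P + R, leaving a margin R n that beats the constants
    margin : ∀ m r₁ n → let R = suc r₁ ; M = suc m * R * R in
             suc m * (R * M * n) ≡ (m * R + r₁) * ((M + R) * n) + R * n
    margin = solve-∀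
    split-constants : ∀ L m R r₁ P n c → L * m + (m * R + r₁) * (P * n + L * (2 * c)) ≡
                      (m * R + r₁) * (P * n) + (L * m + (m * R + r₁) * (L * (2 * c)))
    split-constants = solve-∀

corollary3p5 :
    (r : ℕ) → .{{_ : NonZero r}} → 2 ≤ r →
    {k : ℕ} (F : Graph k) (exF : ℕ → ℕ) → (∀ n → IsEx F n (exF n)) →
    (∃[ C ] (∀ n → ∣ + exF n ℤ.- + t r n ∣ ≤ C)) →
    (c0 : ℤ) → IsLimSup (λ n → + exF n ℤ.- + t r n) c0 →
    Σ ℚ λ ε0 → (0ℚ ℚ.< ε0) ×
      ((ε : ℚ) → 0ℚ ℚ.< ε → ε ℚ.< ε0 →
        ∃[ N ] ((n : ℕ) → N ≤ n →
          (G : Graph n) →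
          (∀ v → (1ℚ ℚ.- (+ 1 ℚ./ r) ℚ.- ε) ℚ.* (+ n ℚ./ 1) ℚ.< (+ deg G v ℚ./ 1)) →
          Saturated F G →
          (part : Fin n → Fin r) →
          (∀ i → + edgesIn G (inPart part i) ℤ.≤ c0) →
          ((∀ i → + sizeA G part i ℤ.≤ + 2 ℤ.* c0)
           × (+ edgesOut G part ℤ.≤ + (2 * (r ∸ 1) * r) ℤ.* (c0 ℤ.* c0))
           × (∀ i u w → inPart part i u ≡ true → degIn G (inPart part i) u ≡ 0 →
                inPart part i w ≡ false → adj G u w ≡ true))))
-- The extremal-number hypotheses only serve to define c₀; the argument uses nothing but e(V_i) ≤ c₀.
corollary3p5 (suc (suc r₀)) _ {k} F _ _ _ (+ c) _ =
  + 1 ℚ./ M , QP.positive⁻¹ (+ 1 ℚ./ M) {{QP.normalize-pos 1 M}} ,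
  λ ε _ ε<1/M → suc threshold , λ n threshold<n G degree saturated part sparseℤ →
    let sparse : ∀ i → edgesIn G (inPart part i) ≤ c
        sparse i = ZP.drop‿+≤+ (sparseℤ i)
        open SparseParts G part sparse
        open AlmostTuran {L} {P} (λ v → nonDeg-bound G (suc r₀) (ℕ.pred M) ε<1/M v (degree v))
        complete = saturated⇒BComplete {F = F} saturated (large n threshold<n)
    in (λ i → subst (+ sizeA G part i ℤ.≤_) (ZP.pos-* 2 c) (ℤ.+≤+ (sizeA≤2c i)))
     , subst (+ edgesOut G part ℤ.≤_) (pos-*-* (2 * suc r₀ * R) c c) (ℤ.+≤+ (edgesOut≤ complete))
     , complete
  where
  open TuranConstants (suc r₀) k c
  pos-*-* : ∀ a b d → + (a * (b * d)) ≡ + a ℤ.* (+ b ℤ.* + d)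
  pos-*-* a b d = trans (ZP.pos-* a (b * d)) (cong (ℤ._*_ (+ a)) (ZP.pos-* b d))
corollary3p5 (suc zero) (s≤s ())
corollary3p5 (suc (suc _)) _ _ _ _ _ -[1+ _ ] _ =
  1ℚ , QP.positive⁻¹ 1ℚ , λ _ _ _ → 0 , λ _ _ _ _ _ _ sparseℤ → ⊥-elim (negative (sparseℤ 0F))
  where
  negative : ∀ {a b} → ¬ (+ a ℤ.≤ -[1+ b ])
  negative ()
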